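{- Suppose $0<k<\ell<\omega$ and $t$ is an aligned type of width $k$ and length $\ell$. Then for some positive integer $m$ there is a sequence $\langle u_j \mid j \le 2m\rangle$ of elements of $[\mathrm{Ord}]^k$ such that $\mathrm{tp}(u_{2j},u_{2j+1}) = \mathrm{tp}(u_{2j+2},u_{2j+1}) = t$ for all $j<m$, and $\mathrm{tp}(u_0,u_{2m}) = t$.
   Context: For natural numbers $0<k<\ell$, a type of width $k$ and length $\ell$ is a function $t:\ell\to 3$ with $|t^{ -1}[\{0,2\}]| = |t^{ -1}[\{1,2\}]| = k$. For $u,v\in[\mathrm{Ord}]^k$ with increasing enumeration $\langle \alpha_i\mid i<\ell\rangle$ of $u\cup v$, $\mathrm{tp}(u,v)$ is the unique type $t$ of width $k$ and length $\ell$ with $u\setminus v=\{\alpha_i: t(i)=0\}$, $v\setminus u=\{\alpha_i: t(i)=1\}$, $u\cap v=\{\alpha_i : t(i)=2\}$. A type $t$ is aligned if $|t^{ -1}[\{0\}]\cap i| = |t^{ -1}[\{1\}]\cap i|$ for all $i\in t^{ -1}[\{2\}]$. -}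

module Defs where

open import Data.Nat using (ℕ; zero; suc; _+_; _<_; _<ᵇ_)
open import Data.Bool using (Bool; true; false; if_then_else_; _∧_; T)
open import Data.Fin using (Fin; toℕ) renaming (zero to fz; suc to fs; _<_ to _<F_)
open import Data.Product using (Σ; ∃; _×_)
open import Relation.Binary.PropositionalEquality using (_≡_)

countF : ∀ {n} → (Fin n → Bool) → ℕ
countF {zero} f = 0
countF {suc n} f = (if f fz then 1 else 0) + countF (λ i → f (fs i))

inU : Fin 3 → Bool
inU fz = true
inU (fs fz) = false
inU (fs (fs _)) = true

inV : Fin 3 → Bool
inV fz = false
inV (fs fz) = true
inV (fs (fs _)) = true

is0 : Fin 3 → Bool
is0 fz = true
is0 (fs _) = false

is1 : Fin 3 → Bool
is1 (fs fz) = true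
is1 _ = false

two : Fin 3
two = fs (fs fz)

IsTypeOfWidth : ∀ {ℓ} → ℕ → (Fin ℓ → Fin 3) → Set
IsTypeOfWidth k t = (countF (λ i → inU (t i)) ≡ k) × (countF (λ i → inV (t i)) ≡ k)

Aligned : ∀ {ℓ} → (Fin ℓ → Fin 3) → Set
Aligned {ℓ} t = (i : Fin ℓ) → t i ≡ two →
  countF (λ j → (toℕ j <ᵇ toℕ i) ∧ is0 (t j)) ≡ countF (λ j → (toℕ j <ᵇ toℕ i) ∧ is1 (t j))

StrictInc : ∀ {n} → (Fin n → ℕ) → Set
StrictInc {n} f = (i j : Fin n) → i <F j → f i < f j

-- [Ord]^k, with ordinals restricted to ℕ: a k-element set,
-- given by its strictly increasing enumeration.
KSet : ℕ → Set
KSet k = Σ (Fin k → ℕ) StrictInc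

_∈ₛ_ : ∀ {k} → ℕ → KSet k → Set
x ∈ₛ (f Data.Product., _) = ∃ λ j → f j ≡ x

-- tp(u,v) = t : with α the increasing enumeration of u ∪ v (length ℓ),
-- u = {α i : t i ∈ {0,2}}, v = {α i : t i ∈ {1,2}}.
TpIs : ∀ {k ℓ} → KSet k → KSet k → (Fin ℓ → Fin 3) → Set
TpIs {k} {ℓ} u v t = Σ (Fin ℓ → ℕ) λ α → StrictInc α ×
  ((x : ℕ) → (x ∈ₛ u → ∃ λ i → α i ≡ x × T (inU (t i))) × ((∃ λ i → α i ≡ x × T (inU (t i))) → x ∈ₛ u)) ×
  ((x : ℕ) → (x ∈ₛ v → ∃ λ i → α i ≡ x × T (inV (t i))) × ((∃ λ i → α i ≡ x × T (inV (t i))) → x ∈ₛ v))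

module Submission where

-- Read the ℓ positions of t as points: the U-positions are those labelled 0 or 2, the V-positions
-- those labelled 1 or 2, and any strictly increasing placement f of the positions gives a pair
-- (f[U], f[V]) of type t. Let P i = K (i + 1) and let Q be an increasing placement sending the a-th
-- U-position to P of the a-th V-position; alignment says that the a-th U- and V-positions coincide
-- whenever one of them is shared, so Q = P on shared positions. Put C s = (N - s) P + s Q and let
-- u (2s), u (2s+1) be the U- and V-parts of C s. Passing from C s to C (s+1) moves each point by at
-- most K², less than the gap N between neighbouring points, so moving only the points labelled 0
-- keeps the placement increasing and realises (u (2s+2), u (2s+1)); shared points do not move.
-- Finally u (2N) = N Q[U] = N P[V] while u 0 = N P[U], so N P realises (u 0, u (2N)).

open import Defs
open import Data.Bool using (Bool; true; false; if_then_else_; _∧_; T)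
open import Data.Bool.Properties using (T-≡; ¬-not)
open import Data.Empty using (⊥-elim)
open import Data.Fin using (Fin; toℕ; fromℕ<) renaming (zero to fzero; suc to fsuc)
open import Data.Fin.Properties using (toℕ-fromℕ<; fromℕ<-toℕ; toℕ<n)
open import Data.Nat using (ℕ; zero; suc; _+_; _*_; _∸_; _<_; _≤_; _<ᵇ_; z≤n; s≤s; z<s; s<s)
open import Data.Nat.Properties
open import Data.Nat.Tactic.RingSolver using (solve-∀)
open import Data.Product using (Σ; ∃; _×_; _,_; proj₁; proj₂)
open import Data.Sum using (_⊎_; inj₁; inj₂)
open import Function.Bundles using (Equivalence)
open import Relation.Nullary using (yes; no)
open import Relation.Binary.Definitions using (tri<; tri≈; tri>)
open import Relation.Binary.PropositionalEquality

bit : Bool → ℕ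
bit b = if b then 1 else 0

count : (ℕ → Bool) → ℕ → ℕ
count p zero = 0
count p (suc n) = count p n + bit (p n)

count-suc : ∀ p n → count p (suc n) ≡ bit (p 0) + count (λ j → p (suc j)) n
count-suc p zero = +-comm 0 (bit (p 0))
count-suc p (suc n) = begin
  count p (suc n) + bit (p (suc n))                               ≡⟨ cong (_+ bit (p (suc n))) (count-suc p n) ⟩
  bit (p 0) + count (λ j → p (suc j)) n + bit (p (suc n))         ≡⟨ +-assoc (bit (p 0)) _ _ ⟩
  bit (p 0) + count (λ j → p (suc j)) (suc n)                     ∎
  where open ≡-Reasoning

countF-toℕ : ∀ n (p : ℕ → Bool) → countF {n} (λ i → p (toℕ i)) ≡ count p n
countF-toℕ zero p = refl
countF-toℕ (suc n) p = trans (cong (bit (p 0) +_) (countF-toℕ n (λ j → p (suc j)))) (sym (count-suc p n))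

countF-cong : ∀ {n} {f g : Fin n → Bool} → (∀ i → f i ≡ g i) → countF f ≡ countF g
countF-cong {zero} f≗g = refl
countF-cong {suc n} f≗g = cong₂ _+_ (cong bit (f≗g fzero)) (countF-cong (λ i → f≗g (fsuc i)))

count-cong : ∀ {p q} n → (∀ j → j < n → p j ≡ q j) → count p n ≡ count q n
count-cong zero p≗q = refl
count-cong (suc n) p≗q = cong₂ _+_ (count-cong n (λ j j<n → p≗q j (m<n⇒m<1+n j<n))) (cong bit (p≗q n ≤-refl))

count-below : ∀ p {m} n → m ≤ n → count (λ j → (j <ᵇ m) ∧ p j) n ≡ count p m
count-below p zero z≤n = refl
count-below p {m} (suc n) m≤1+n with m≤n⇒m<n∨m≡n m≤1+n
... | inj₂ refl = count-cong (suc n) (λ j j<m → cong (_∧ p j) (Equivalence.to T-≡ (<⇒<ᵇ j<m)))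
... | inj₁ (s≤s m≤n) = begin
  count (λ j → (j <ᵇ m) ∧ p j) n + bit ((n <ᵇ m) ∧ p n) ≡⟨ cong₂ _+_ (count-below p n m≤n) (cong (λ b → bit (b ∧ p n)) n≮ᵇm) ⟩
  count p m + 0                                          ≡⟨ +-identityʳ (count p m) ⟩
  count p m                                              ∎
  where
  open ≡-Reasoning
  n≮ᵇm : (n <ᵇ m) ≡ false
  n≮ᵇm = ¬-not (λ n<ᵇm → <⇒≱ (<ᵇ⇒< n m (subst T (sym n<ᵇm) _)) m≤n)

count-+ : ∀ p q r → (∀ j → bit (p j) ≡ bit (q j) + bit (r j)) → ∀ n → count p n ≡ count q n + count r n
count-+ p q r split zero = refl
count-+ p q r split (suc n) rewrite count-+ p q r split n | split n =
  interchange (count q n) (count r n) (bit (q n)) (bit (r n))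
  where
  interchange : ∀ a b c d → a + b + (c + d) ≡ a + c + (b + d)
  interchange = solve-∀

count-mono : ∀ p {m n} → m ≤ n → count p m ≤ count p n
count-mono p {n = zero} z≤n = z≤n
count-mono p {n = suc n} m≤1+n with m≤n⇒m<n∨m≡n m≤1+n
... | inj₂ refl = ≤-refl
... | inj₁ (s≤s m≤n) = ≤-trans (count-mono p m≤n) (m≤m+n (count p n) _)

count-suc-true : ∀ p {i} → p i ≡ true → count p (suc i) ≡ suc (count p i)
count-suc-true p {i} pi rewrite pi = +-comm (count p i) 1

count-strict : ∀ p {i j} → p i ≡ true → i < j → count p i < count p j
count-strict p {j = j} pi i<j = subst (_≤ count p j) (count-suc-true p pi) (count-mono p i<j)

count-injective : ∀ p {i j} → p i ≡ true → p j ≡ true → count p i ≡ count p j → i ≡ j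
count-injective p {i} {j} pi pj eq with <-cmp i j
... | tri< i<j _ _ = ⊥-elim (<-irrefl eq (count-strict p pi i<j))
... | tri≈ _ i≡j _ = i≡j
... | tri> _ _ j<i = ⊥-elim (<-irrefl (sym eq) (count-strict p pj j<i))

module Enumeration (p : ℕ → Bool) (L : ℕ) where

  -- The candidate is produced unconditionally, so that nth needs no proof argument.
  hit : ∀ a n → Σ ℕ λ i → a < count p n → i < n × p i ≡ true × count p i ≡ a
  hit a zero = 0 , λ ()
  hit a (suc n) with a <? count p n | p n in pn
  ... | yes a<c | _ = let (i , h) = hit a n in
    i , λ _ → let (i<n , pi , ci) = h a<c in m<n⇒m<1+n i<n , pi , ci
  ... | no a≮c | true = n , λ a<c+1 →
    ≤-refl , pn , ≤-antisym (≮⇒≥ a≮c) (m<1+n⇒m≤n (subst (a <_) (+-comm (count p n) 1) a<c+1))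
  ... | no a≮c | false = n , λ a<c+0 → ⊥-elim (a≮c (subst (a <_) (+-identityʳ (count p n)) a<c+0))

  nth : ℕ → ℕ
  nth a = proj₁ (hit a L)

  module _ {a} (a<c : a < count p L) where

    nth<L : nth a < L
    nth<L = proj₁ (proj₂ (hit a L) a<c)

    nth-true : p (nth a) ≡ true
    nth-true = proj₁ (proj₂ (proj₂ (hit a L) a<c))

    count-nth : count p (nth a) ≡ a
    count-nth = proj₂ (proj₂ (proj₂ (hit a L) a<c))

  nth-strictMono : ∀ {a b} → a < b → b < count p L → nth a < nth b
  nth-strictMono {a} {b} a<b b<c = ≰⇒> λ nb≤na →
    <⇒≱ a<b (subst₂ _≤_ (count-nth b<c) (count-nth (<-trans a<b b<c)) (count-mono p nb≤na))

  nth-count : ∀ {i} → i < L → p i ≡ true → nth (count p i) ≡ i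
  nth-count i<L pi = count-injective p (nth-true c<) pi (count-nth c<)
    where c< = count-strict p pi i<L

weighted-strictMono : ∀ r s {x y x′ y′} → 0 < r + s → x < x′ → y < y′ → r * x + s * y < r * x′ + s * y′
weighted-strictMono (suc r) s _ x<x′ y<y′ = +-mono-<-≤ (*-monoʳ-< (suc r) x<x′) (*-monoʳ-≤ s (<⇒≤ y<y′))
weighted-strictMono zero (suc s) _ x<x′ y<y′ = *-monoʳ-< (suc s) y<y′

weighted-shift : ∀ r s {x y x′ y′} → x < x′ → y < y′ → y ≤ r + s → r * x + suc s * y < suc r * x′ + s * y′
weighted-shift r s {x} {y} {x′} {y′} x<x′ y<y′ y≤r+s = begin-strict
  r * x + suc s * y                  ≡⟨ lhs r s x y ⟩
  (r * x + s * y) + y                <⟨ +-monoʳ-< (r * x + s * y) (s≤s (≤-trans y≤r+s (m≤n+m (r + s) x))) ⟩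
  (r * x + s * y) + suc (x + (r + s)) ≡⟨ rhs r s x y ⟩
  suc r * suc x + s * suc y          ≤⟨ +-mono-≤ (*-monoʳ-≤ (suc r) x<x′) (*-monoʳ-≤ s y<y′) ⟩
  suc r * x′ + s * y′                ∎
  where
  open ≤-Reasoning
  lhs : ∀ r s x y → r * x + suc s * y ≡ (r * x + s * y) + y
  lhs = solve-∀
  rhs : ∀ r s x y → (r * x + s * y) + suc (x + (r + s)) ≡ suc r * suc x + s * suc y
  rhs = solve-∀

IncreasingBelow : ℕ → (ℕ → ℕ) → Set
IncreasingBelow L f = ∀ {i j} → i < j → j < L → f i < f j

module Labelling {ℓ} (t : Fin ℓ → Fin 3) where

  -- Positions ≥ ℓ get an arbitrary label; they are never inspected.
  lab : ℕ → Fin 3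
  lab n with n <? ℓ
  ... | yes n<ℓ = t (fromℕ< n<ℓ)
  ... | no _ = fzero

  lab-fromℕ< : ∀ {n} (n<ℓ : n < ℓ) → lab n ≡ t (fromℕ< n<ℓ)
  lab-fromℕ< {n} n<ℓ with n <? ℓ
  ... | yes _ = refl
  ... | no n≮ℓ = ⊥-elim (n≮ℓ n<ℓ)

  lab-toℕ : ∀ i → lab (toℕ i) ≡ t i
  lab-toℕ i = trans (lab-fromℕ< (toℕ<n i)) (cong t (fromℕ<-toℕ i (toℕ<n i)))

  labelled : (Fin 3 → Bool) → ℕ → Bool
  labelled σ n = σ (lab n)

  countF-lab : ∀ σ → countF (λ i → σ (t i)) ≡ count (labelled σ) ℓ
  countF-lab σ = trans (countF-cong (λ i → cong σ (sym (lab-toℕ i)))) (countF-toℕ ℓ (labelled σ))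

  countF-before : ∀ σ {i} (i<ℓ : i < ℓ) →
    countF (λ j → (toℕ j <ᵇ toℕ (fromℕ< i<ℓ)) ∧ σ (t j)) ≡ count (labelled σ) i
  countF-before σ {i} i<ℓ = begin
    countF (λ j → (toℕ j <ᵇ toℕ (fromℕ< i<ℓ)) ∧ σ (t j)) ≡⟨ countF-cong (λ j → cong₂ (λ m c → (toℕ j <ᵇ m) ∧ σ c) (toℕ-fromℕ< i<ℓ) (sym (lab-toℕ j))) ⟩
    countF {ℓ} (λ j → (toℕ j <ᵇ i) ∧ labelled σ (toℕ j)) ≡⟨ countF-toℕ ℓ (λ n → (n <ᵇ i) ∧ labelled σ n) ⟩
    count (λ n → (n <ᵇ i) ∧ labelled σ n) ℓ             ≡⟨ count-below (labelled σ) ℓ (<⇒≤ i<ℓ) ⟩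
    count (labelled σ) i                                ∎
    where open ≡-Reasoning

  module Side (σ : Fin 3 → Bool) {k} (width : countF (λ i → σ (t i)) ≡ k) where

    open Enumeration (labelled σ) ℓ public

    total : count (labelled σ) ℓ ≡ k
    total = trans (sym (countF-lab σ)) width

    below : ∀ {a} → a < k → a < count (labelled σ) ℓ
    below {a} = subst (a <_) (sym total)

    restrict : (f : ℕ → ℕ) → IncreasingBelow ℓ f → KSet k
    restrict f f↑ = (λ a → f (nth (toℕ a))) ,
      λ a b a<b → f↑ (nth-strictMono a<b (below (toℕ<n b))) (nth<L (below (toℕ<n b)))

    Enumerates : KSet k → (ℕ → ℕ) → Set
    Enumerates w f = ∀ a → proj₁ w a ≡ f (nth (toℕ a))

    module _ (w : KSet k) (f : ℕ → ℕ) (w≗f : Enumerates w f) (x : ℕ) where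

      ∈ₛ⇒labelled : x ∈ₛ w → ∃ λ i → f (toℕ i) ≡ x × T (σ (t i))
      ∈ₛ⇒labelled (a , wa≡x) = fromℕ< nth<ℓ , fi≡x , Equivalence.from T-≡ σti
        where
        a< = below (toℕ<n a)
        nth<ℓ = nth<L a<
        fi≡x = trans (cong f (toℕ-fromℕ< nth<ℓ)) (trans (sym (w≗f a)) wa≡x)
        σti = trans (cong σ (sym (lab-fromℕ< nth<ℓ))) (nth-true a<)

      labelled⇒∈ₛ : (∃ λ i → f (toℕ i) ≡ x × T (σ (t i))) → x ∈ₛ w
      labelled⇒∈ₛ (i , fi≡x , σti) = fromℕ< c<k , (begin
        proj₁ w (fromℕ< c<k)            ≡⟨ w≗f _ ⟩
        f (nth (toℕ (fromℕ< c<k)))      ≡⟨ cong (λ c → f (nth c)) (toℕ-fromℕ< c<k) ⟩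
        f (nth (count _ (toℕ i)))       ≡⟨ cong f (nth-count (toℕ<n i) σi) ⟩
        f (toℕ i)                       ≡⟨ fi≡x ⟩
        x                               ∎)
        where
        open ≡-Reasoning
        σi = trans (cong σ (lab-toℕ i)) (Equivalence.to T-≡ σti)
        c<k = subst (_ <_) total (count-strict (labelled σ) σi (toℕ<n i))

  module Realise {k} (width : IsTypeOfWidth k t) where

    module U = Side inU (proj₁ width)
    module V = Side inV (proj₂ width)

    tp-realise : ∀ (f : ℕ → ℕ) → IncreasingBelow ℓ f → ∀ u v → U.Enumerates u f → V.Enumerates v f → TpIs u v t
    tp-realise f f↑ u v u≗f v≗f =
      (λ i → f (toℕ i)) ,
      (λ i j i<j → f↑ i<j (toℕ<n j)) ,
      (λ x → U.∈ₛ⇒labelled u f u≗f x , U.labelled⇒∈ₛ u f u≗f x) ,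
      (λ x → V.∈ₛ⇒labelled v f v≗f x , V.labelled⇒∈ₛ v f v≗f x)

is2 : Fin 3 → Bool
is2 (fsuc (fsuc _)) = true
is2 _ = false

inU-split : ∀ c → bit (inU c) ≡ bit (is0 c) + bit (is2 c)
inU-split fzero = refl
inU-split (fsuc fzero) = refl
inU-split (fsuc (fsuc fzero)) = refl

inV-split : ∀ c → bit (inV c) ≡ bit (is1 c) + bit (is2 c)
inV-split fzero = refl
inV-split (fsuc fzero) = refl
inV-split (fsuc (fsuc fzero)) = refl

inU-labels : ∀ c → inU c ≡ true → c ≡ fzero ⊎ c ≡ two
inU-labels fzero _ = inj₁ refl
inU-labels (fsuc (fsuc fzero)) _ = inj₂ refl

inV⇒¬is0 : ∀ c → inV c ≡ true → is0 c ≡ false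
inV⇒¬is0 (fsuc _) _ = refl

module Construction {k ℓ} (t : Fin ℓ → Fin 3) (width : IsTypeOfWidth k t) (aligned : Aligned t) where

  open Labelling t
  open Realise width

  count-U≡count-V : ∀ {i} → i < ℓ → lab i ≡ two → count (labelled inU) i ≡ count (labelled inV) i
  count-U≡count-V {i} i<ℓ i-shared = begin
    count (labelled inU) i                             ≡⟨ count-+ _ _ _ (λ n → inU-split (lab n)) i ⟩
    count (labelled is0) i + count (labelled is2) i    ≡⟨ cong (_+ count (labelled is2) i) zeros≡ones ⟩
    count (labelled is1) i + count (labelled is2) i    ≡⟨ count-+ _ _ _ (λ n → inV-split (lab n)) i ⟨
    count (labelled inV) i                             ∎
    where
    open ≡-Reasoning
    zeros≡ones : count (labelled is0) i ≡ count (labelled is1) i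
    zeros≡ones = trans (sym (countF-before is0 i<ℓ))
      (trans (aligned (fromℕ< i<ℓ) (trans (sym (lab-fromℕ< i<ℓ)) i-shared)) (countF-before is1 i<ℓ))

  K : ℕ
  K = suc ℓ

  P : ℕ → ℕ
  P i = K * suc i

  V-cut : ℕ → ℕ
  V-cut zero = 0
  V-cut (suc a) = suc (V.nth a)

  -- Q sends the a-th U-position to P of the a-th V-position; a position outside U is placed just
  -- above the image of the last U-position before it (offset i + 1 < K), which keeps Q increasing.
  Q : ℕ → ℕ
  Q i = K * V-cut (count (labelled inU) (suc i)) + (if labelled inU i then 0 else suc i)

  P-strictMono : IncreasingBelow ℓ P
  P-strictMono i<j _ = *-monoʳ-< K (s<s i<j)

  U≤V : ∀ {c} → c ≤ count (labelled inU) ℓ → c ≤ count (labelled inV) ℓ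
  U≤V {c} = subst (c ≤_) (trans U.total (sym V.total))

  V-cut-strictMono : ∀ {a b} → a < b → b ≤ count (labelled inV) ℓ → V-cut a < V-cut b
  V-cut-strictMono {zero} {suc b} _ _ = z<s
  V-cut-strictMono {suc a} {suc b} (s<s a<b) b<c = s<s (V.nth-strictMono a<b b<c)

  V-cut≤ℓ : ∀ b → b ≤ count (labelled inV) ℓ → V-cut b ≤ ℓ
  V-cut≤ℓ zero _ = z≤n
  V-cut≤ℓ (suc b) b<c = V.nth<L b<c

  Q≤ : ∀ i → Q i ≤ K * V-cut (count (labelled inU) (suc i)) + suc i
  Q≤ i with labelled inU i
  ... | true = +-monoʳ-≤ (K * V-cut _) z≤n
  ... | false = ≤-refl

  Q-offU : ∀ {j} → labelled inU j ≡ false → Q j ≡ K * V-cut (count (labelled inU) (suc j)) + suc j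
  Q-offU {j} jU rewrite jU = refl

  Q-strictMono : IncreasingBelow ℓ Q
  Q-strictMono {i} {j} i<j j<ℓ with m≤n⇒m<n∨m≡n (count-mono (labelled inU) (s≤s (<⇒≤ i<j)))
  ... | inj₁ cᵢ<cⱼ = begin-strict
    Q i                        ≤⟨ Q≤ i ⟩
    K * V-cut cᵢ + suc i       <⟨ +-monoʳ-< (K * V-cut cᵢ) (s<s (<-trans i<j j<ℓ)) ⟩
    K * V-cut cᵢ + K           ≡⟨ trans (+-comm _ K) (sym (*-suc K (V-cut cᵢ))) ⟩
    K * suc (V-cut cᵢ)         ≤⟨ *-monoʳ-≤ K (V-cut-strictMono cᵢ<cⱼ (U≤V (count-mono (labelled inU) j<ℓ))) ⟩
    K * V-cut cⱼ               ≤⟨ m≤m+n (K * V-cut cⱼ) _ ⟩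
    Q j                        ∎
    where
    open ≤-Reasoning
    cᵢ = count (labelled inU) (suc i)
    cⱼ = count (labelled inU) (suc j)
  ... | inj₂ cᵢ≡cⱼ = begin-strict
    Q i                        ≤⟨ Q≤ i ⟩
    K * V-cut cᵢ + suc i       <⟨ +-monoʳ-< (K * V-cut cᵢ) (s<s i<j) ⟩
    K * V-cut cᵢ + suc j       ≡⟨ cong (λ c → K * V-cut c + suc j) cᵢ≡cⱼ ⟩
    K * V-cut cⱼ + suc j       ≡⟨ Q-offU j-offU ⟨
    Q j                        ∎
    where
    open ≤-Reasoning
    cᵢ = count (labelled inU) (suc i)
    cⱼ = count (labelled inU) (suc j)
    j-offU : labelled inU j ≡ false
    j-offU = ¬-not λ jU → <-irrefl cᵢ≡cⱼ
      (subst (cᵢ <_) (sym (count-suc-true (labelled inU) jU)) (s≤s (count-mono (labelled inU) i<j)))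

  Q-onU : ∀ {i} → labelled inU i ≡ true → Q i ≡ P (V.nth (count (labelled inU) i))
  Q-onU {i} iU = trans
    (cong₂ (λ c z → K * V-cut c + z) (count-suc-true (labelled inU) iU) (cong (λ b → if b then 0 else suc i) iU))
    (+-identityʳ (P (V.nth (count (labelled inU) i))))

  Q-U : ∀ {a} → a < k → Q (U.nth a) ≡ P (V.nth a)
  Q-U a<k = trans (Q-onU (U.nth-true (U.below a<k))) (cong (λ c → P (V.nth c)) (U.count-nth (U.below a<k)))

  Q-shared : ∀ {i} → i < ℓ → lab i ≡ two → Q i ≡ P i
  Q-shared {i} i<ℓ i-shared = begin
    Q i                                  ≡⟨ Q-onU (cong inU i-shared) ⟩
    P (V.nth (count (labelled inU) i))   ≡⟨ cong (λ c → P (V.nth c)) (count-U≡count-V i<ℓ i-shared) ⟩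
    P (V.nth (count (labelled inV) i))   ≡⟨ cong P (V.nth-count i<ℓ (cong inV i-shared)) ⟩
    P i                                  ∎
    where open ≡-Reasoning

  K*K≡K*ℓ+K : K * K ≡ K * ℓ + K
  K*K≡K*ℓ+K = trans (*-suc K ℓ) (+-comm K (K * ℓ))

  P≤K*K : ∀ {i} → i < ℓ → P i ≤ K * K
  P≤K*K i<ℓ = *-monoʳ-≤ K (m<n⇒m<1+n i<ℓ)

  Q≤K*K : ∀ {i} → i < ℓ → Q i ≤ K * K
  Q≤K*K {i} i<ℓ = begin
    Q i                                            ≤⟨ Q≤ i ⟩
    K * V-cut (count (labelled inU) (suc i)) + suc i ≤⟨ +-mono-≤ (*-monoʳ-≤ K (V-cut≤ℓ _ (U≤V (count-mono (labelled inU) i<ℓ)))) (m<n⇒m<1+n i<ℓ) ⟩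
    K * ℓ + K                                      ≡⟨ K*K≡K*ℓ+K ⟨
    K * K                                          ∎
    where open ≤-Reasoning

  W : ℕ → ℕ → ℕ → ℕ
  W r s i = r * P i + s * Q i

  W-strictMono : ∀ r s → 0 < r + s → IncreasingBelow ℓ (W r s)
  W-strictMono r s 0<r+s i<j j<ℓ = weighted-strictMono r s 0<r+s (P-strictMono i<j j<ℓ) (Q-strictMono i<j j<ℓ)

  W-shared : ∀ r s {i} → i < ℓ → lab i ≡ two → W r s i ≡ (r + s) * P i
  W-shared r s {i} i<ℓ i-shared = trans (cong (λ q → r * P i + s * q) (Q-shared i<ℓ i-shared)) (sym (*-distribʳ-+ (P i) r s))

  Mix : ℕ → ℕ → ℕ → ℕ
  Mix r s i = if is0 (lab i) then W r (suc s) i else W (suc r) s i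

  -- Each point moves by at most K * K = r + s, while W r (suc s) and W (suc r) s both separate
  -- neighbouring positions by more than r + s.
  Mix-strictMono : ∀ r s → r + s ≡ K * K → IncreasingBelow ℓ (Mix r s)
  Mix-strictMono r s r+s≡K*K {i} {j} i<j j<ℓ = cases (is0 (lab i)) (is0 (lab j))
    where
    i<ℓ = <-trans i<j j<ℓ
    cases : ∀ bᵢ bⱼ → (if bᵢ then W r (suc s) i else W (suc r) s i) < (if bⱼ then W r (suc s) j else W (suc r) s j)
    cases true true = W-strictMono r (suc s) (subst (0 <_) (sym (+-suc r s)) z<s) i<j j<ℓ
    cases false false = W-strictMono (suc r) s z<s i<j j<ℓ
    cases true false = weighted-shift r s (P-strictMono i<j j<ℓ) (Q-strictMono i<j j<ℓ)
      (subst (Q i ≤_) (sym r+s≡K*K) (Q≤K*K i<ℓ))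
    cases false true = subst₂ _<_ (+-comm (s * Q i) (suc r * P i)) (+-comm (suc s * Q j) (r * P j))
      (weighted-shift s r (Q-strictMono i<j j<ℓ) (P-strictMono i<j j<ℓ)
        (subst (P i ≤_) (trans (sym r+s≡K*K) (+-comm r s)) (P≤K*K i<ℓ)))

  Mix-onU : ∀ r s {i} → i < ℓ → labelled inU i ≡ true → Mix r s i ≡ W r (suc s) i
  Mix-onU r s {i} i<ℓ iU with inU-labels (lab i) iU
  ... | inj₁ i-onlyU = cong (λ b → if b then W r (suc s) i else W (suc r) s i) (cong is0 i-onlyU)
  ... | inj₂ i-shared = begin
    Mix r s i           ≡⟨ cong (λ b → if b then W r (suc s) i else W (suc r) s i) (cong is0 i-shared) ⟩
    W (suc r) s i       ≡⟨ W-shared (suc r) s i<ℓ i-shared ⟩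
    (suc r + s) * P i   ≡⟨ cong (_* P i) (+-suc r s) ⟨
    (r + suc s) * P i   ≡⟨ W-shared r (suc s) i<ℓ i-shared ⟨
    W r (suc s) i       ∎
    where open ≡-Reasoning

  Mix-onV : ∀ r s {i} → labelled inV i ≡ true → Mix r s i ≡ W (suc r) s i
  Mix-onV r s {i} iV = cong (λ b → if b then W r (suc s) i else W (suc r) s i) (inV⇒¬is0 (lab i) iV)

  N : ℕ
  N = suc (K * K)

  C : ℕ → ℕ → ℕ
  C s = W (N ∸ s) s

  C-strictMono : ∀ s → IncreasingBelow ℓ (C s)
  C-strictMono zero = W-strictMono N 0 z<s
  C-strictMono (suc s) = W-strictMono (N ∸ suc s) (suc s) (subst (0 <_) (+-comm (suc s) _) z<s)

  even odd : ℕ → KSet k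
  even s = U.restrict (C s) (C-strictMono s)
  odd s = V.restrict (C s) (C-strictMono s)

  tp-even-odd : ∀ s → TpIs (even s) (odd s) t
  tp-even-odd s = tp-realise (C s) (C-strictMono s) (even s) (odd s) (λ _ → refl) (λ _ → refl)

  tp-next-odd : ∀ s → s < N → TpIs (even (suc s)) (odd s) t
  tp-next-odd s s<N = tp-realise (Mix r s) (Mix-strictMono r s r+s≡K*K) (even (suc s)) (odd s)
    (λ a → sym (Mix-onU r s (U.nth<L (U.below (toℕ<n a))) (U.nth-true (U.below (toℕ<n a)))))
    (λ b → trans (cong (λ w → W w s (V.nth (toℕ b))) N∸s≡1+r) (sym (Mix-onV r s (V.nth-true (V.below (toℕ<n b))))))
    where
    r = N ∸ suc s
    N∸s≡1+r : N ∸ s ≡ suc r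
    N∸s≡1+r = +-∸-assoc 1 s<N
    r+s≡K*K : r + s ≡ K * K
    r+s≡K*K = suc-injective (trans (cong (_+ s) (sym N∸s≡1+r)) (m∸n+n≡m (<⇒≤ s<N)))

  tp-first-last : TpIs (even 0) (even N) t
  tp-first-last = tp-realise (λ i → N * P i) (λ i<j j<ℓ → *-monoʳ-< N (P-strictMono i<j j<ℓ)) (even 0) (even N)
    (λ a → +-identityʳ (N * P (U.nth (toℕ a))))
    (λ b → trans (cong (λ w → w * P (U.nth (toℕ b)) + N * Q (U.nth (toℕ b))) (n∸n≡0 N)) (cong (N *_) (Q-U (toℕ<n b))))

interleave : ∀ {A : Set} → (ℕ → A) → (ℕ → A) → ℕ → A
interleave e o zero = e 0
interleave e o (suc zero) = o 0
interleave e o (suc (suc n)) = interleave (λ j → e (suc j)) (λ j → o (suc j)) n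

interleave-even : ∀ {A : Set} (e o : ℕ → A) j → interleave e o (2 * j) ≡ e j
interleave-even e o zero = refl
interleave-even e o (suc j) = trans (cong (interleave e o) (*-suc 2 j)) (interleave-even (λ j → e (suc j)) (λ j → o (suc j)) j)

interleave-odd : ∀ {A : Set} (e o : ℕ → A) j → interleave e o (2 * j + 1) ≡ o j
interleave-odd e o zero = refl
interleave-odd e o (suc j) = trans (cong (λ n → interleave e o (n + 1)) (*-suc 2 j)) (interleave-odd (λ j → e (suc j)) (λ j → o (suc j)) j)

interleave-next : ∀ {A : Set} (e o : ℕ → A) j → interleave e o (2 * j + 2) ≡ e (suc j)
interleave-next e o zero = refl
interleave-next e o (suc j) = trans (cong (λ n → interleave e o (n + 2)) (*-suc 2 j)) (interleave-next (λ j → e (suc j)) (λ j → o (suc j)) j)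

lemma3p5 : (k ℓ : ℕ) → 0 < k → k < ℓ → (t : Fin ℓ → Fin 3) → IsTypeOfWidth k t → Aligned t →
    ∃ λ (m : ℕ) → 0 < m × Σ (ℕ → KSet k) (λ u →
      ((j : ℕ) → j < m → TpIs (u (2 * j)) (u (2 * j + 1)) t × TpIs (u (2 * j + 2)) (u (2 * j + 1)) t)
      × TpIs (u 0) (u (2 * m)) t)
lemma3p5 k ℓ _ _ t width aligned = N , z<s , interleave even odd , (λ j j<N → forward j , backward j j<N) , closing
  where
  open Construction t width aligned
  forward : ∀ j → TpIs (interleave even odd (2 * j)) (interleave even odd (2 * j + 1)) t
  forward j rewrite interleave-even even odd j | interleave-odd even odd j = tp-even-odd j
  backward : ∀ j → j < N → TpIs (interleave even odd (2 * j + 2)) (interleave even odd (2 * j + 1)) t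
  backward j j<N rewrite interleave-next even odd j | interleave-odd even odd j = tp-next-odd j j<N
  closing : TpIs (interleave even odd 0) (interleave even odd (2 * N)) t
  closing rewrite interleave-even even odd N = tp-first-last
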